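{- Let $B$ and $V$ be finite disjoint sets of propositional variables and let $\mathcal{E} = \{x \leftrightarrow \phi_x \mid x\in B\}$ be an orderable $(B,V)$-modal equational system. Then $\mathcal{E}$ has a solution in $\mathsf{IL}$, and it is unique up to logical equivalence: if $x\mapsto\psi_x$ and $x\mapsto\psi'_x$ are both solutions, then $\mathsf{IL}\vdash\psi_x\leftrightarrow\psi'_x$ for every $x\in B$.
   Context: Formulas: $\phi ::= p \mid \bot \mid \phi\to\phi \mid \phi\rhd\phi$, with $p$ ranging over propositional variables; $\mathrm{voc}(\phi)$ denotes the set of variables occurring in $\phi$. Abbreviations: $\neg\phi := \phi\to\bot$, $\phi\vee\psi := \neg\phi\to\psi$, $\phi\wedge\psi := \neg(\phi\to\neg\psi)$, $\Box\phi := \neg\phi\rhd\bot$, $\Diamond\phi := \neg(\phi\rhd\bot)$. $\mathsf{IL}$ is the smallest set of formulas containing all classical propositional tautologies and all instances of (K) $\Box(\phi\to\psi)\to(\Box\phi\to\Box\psi)$, (4) $\Box\phi\to\Box\Box\phi$, (L) $\Box(\Box\phi\to\phi)\to\Box\phi$, (J1) $\Box(\phi\to\psi)\to(\phi\rhd\psi)$, (J2) $(\phi\rhd\chi)\wedge(\chi\rhd\psi)\to(\phi\rhd\psi)$, (J3) $(\phi\rhd\psi)\wedge(\chi\rhd\psi)\to((\phi\vee\chi)\rhd\psi)$, (J4) $\phi\rhd\psi\to(\Diamond\phi\to\Diamond\psi)$, (J5) $\Diamond\phi\rhd\phi$, closed under modus ponens and necessitation. A formula is modalized in a variable $p$ if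 every occurrence of $p$ in it lies within the scope of a $\rhd$. A $(B,V)$-modal equational system is a set $\{x\leftrightarrow\phi_x\mid x\in B\}$ with $\mathrm{voc}(\phi_x)\subseteq B\cup V$ for each $x\in B$. It is orderable if there is an enumeration $x_0,\dots,x_n$ of $B$ such that for all $i\le j$, $\phi_{x_j}$ is modalized in $x_i$. A solution in $\mathsf{IL}$ is a map $y\in B\mapsto\psi_y$ such that for each $x\in B$: $\mathrm{voc}(\psi_x)\subseteq V$ and $\mathsf{IL}\vdash\psi_x\leftrightarrow\phi_x[y\mapsto\psi_y]_{y\in B}$ (simultaneous substitution). -}

module Defs where

open import Data.Nat using (ℕ; _≤_; _<_)
open import Data.Nat.Properties using (_≟_)
open import Data.Bool using (Bool; true; false; if_then_else_; not; _∨_)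
open import Data.List using (List; length; lookup)
open import Data.List.Membership.Propositional using (_∈_)
open import Data.List.Membership.DecPropositional _≟_ using (_∈?_)
open import Data.List.Relation.Binary.Permutation.Propositional using (_↭_)
open import Data.Fin using (Fin; toℕ)
open import Data.Product using (Σ; _×_)
open import Data.Sum using (_⊎_)
open import Data.Unit using (⊤)
open import Data.Empty using (⊥)
open import Relation.Binary.PropositionalEquality using (_≡_; _≢_)
open import Relation.Nullary using (¬_)
open import Relation.Nullary.Decidable using (⌊_⌋)

Var : Set
Var = ℕ

infixr 6 _⇒_
infixr 7 _▷_
data Fm : Set where
  var : Var → Fm
  ⊥' : Fm
  _⇒_ : Fm → Fm → Fm
  _▷_ : Fm → Fm → Fm

¬' : Fm → Fm
¬' φ = φ ⇒ ⊥'

_∨'_ : Fm → Fm → Fm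
φ ∨' ψ = ¬' φ ⇒ ψ

_∧'_ : Fm → Fm → Fm
φ ∧' ψ = ¬' (φ ⇒ ¬' ψ)

_⇔_ : Fm → Fm → Fm
φ ⇔ ψ = (φ ⇒ ψ) ∧' (ψ ⇒ φ)

□ : Fm → Fm
□ φ = ¬' φ ▷ ⊥'

◇ : Fm → Fm
◇ φ = ¬' (φ ▷ ⊥')

-- Classical evaluation: ▷-formulas and variables are treated as atoms,
-- valued by an arbitrary assignment on formulas.
eval : (Fm → Bool) → Fm → Bool
eval v (var p) = v (var p)
eval v ⊥' = false
eval v (φ ⇒ ψ) = not (eval v φ) ∨ eval v ψ
eval v (φ ▷ ψ) = v (φ ▷ ψ)

Tautology : Fm → Set
Tautology φ = (v : Fm → Bool) → eval v φ ≡ true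

data IL⊢ : Fm → Set where
  taut : ∀ {φ} → Tautology φ → IL⊢ φ
  axK  : ∀ φ ψ → IL⊢ (□ (φ ⇒ ψ) ⇒ (□ φ ⇒ □ ψ))
  ax4  : ∀ φ → IL⊢ (□ φ ⇒ □ (□ φ))
  axL  : ∀ φ → IL⊢ (□ (□ φ ⇒ φ) ⇒ □ φ)
  axJ1 : ∀ φ ψ → IL⊢ (□ (φ ⇒ ψ) ⇒ (φ ▷ ψ))
  axJ2 : ∀ φ χ ψ → IL⊢ (((φ ▷ χ) ∧' (χ ▷ ψ)) ⇒ (φ ▷ ψ))
  axJ3 : ∀ φ χ ψ → IL⊢ (((φ ▷ ψ) ∧' (χ ▷ ψ)) ⇒ ((φ ∨' χ) ▷ ψ))
  axJ4 : ∀ φ ψ → IL⊢ ((φ ▷ ψ) ⇒ (◇ φ ⇒ ◇ ψ))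
  axJ5 : ∀ φ → IL⊢ (◇ φ ▷ φ)
  mp   : ∀ {φ ψ} → IL⊢ (φ ⇒ ψ) → IL⊢ φ → IL⊢ ψ
  nec  : ∀ {φ} → IL⊢ φ → IL⊢ (□ φ)

data Occurs (p : Var) : Fm → Set where
  here  : Occurs p (var p)
  ⇒ˡ : ∀ {φ ψ} → Occurs p φ → Occurs p (φ ⇒ ψ)
  ⇒ʳ : ∀ {φ ψ} → Occurs p ψ → Occurs p (φ ⇒ ψ)
  ▷ˡ : ∀ {φ ψ} → Occurs p φ → Occurs p (φ ▷ ψ)
  ▷ʳ : ∀ {φ ψ} → Occurs p ψ → Occurs p (φ ▷ ψ)

VocIn : Fm → (Var → Set) → Set
VocIn φ S = ∀ p → Occurs p φ → S p

Modalized : Var → Fm → Set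
Modalized p (var q) = q ≢ p
Modalized p ⊥' = ⊤
Modalized p (φ ⇒ ψ) = Modalized p φ × Modalized p ψ
Modalized p (φ ▷ ψ) = ⊤

Disjoint : List Var → List Var → Set
Disjoint B V = ∀ p → p ∈ B → ¬ (p ∈ V)

sub : (Var → Fm) → Fm → Fm
sub σ (var p) = σ p
sub σ ⊥' = ⊥'
sub σ (φ ⇒ ψ) = sub σ φ ⇒ sub σ ψ
sub σ (φ ▷ ψ) = sub σ φ ▷ sub σ ψ

subOn : List Var → (Var → Fm) → Var → Fm
subOn B ψ y = if ⌊ y ∈? B ⌋ then ψ y else var y

-- A (B,V)-modal equational system {x ↔ φ_x | x ∈ B}, given by φ : Var → Fm
-- (only its values on B matter): voc(φ_x) ⊆ B ∪ V for x ∈ B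
IsSystem : List Var → List Var → (Var → Fm) → Set
IsSystem B V φ = ∀ x → x ∈ B → VocIn (φ x) (λ p → p ∈ B ⊎ p ∈ V)

Orderable : List Var → (Var → Fm) → Set
Orderable B φ = Σ (List Var) λ L → (L ↭ B) ×
  ((i j : Fin (length L)) → toℕ i ≤ toℕ j → Modalized (lookup L i) (φ (lookup L j)))

IsSolution : List Var → List Var → (Var → Fm) → (Var → Fm) → Set
IsSolution B V φ ψ = ∀ x → x ∈ B →
  VocIn (ψ x) (λ p → p ∈ V) × IL⊢ (ψ x ⇔ sub (subOn B ψ) (φ x))

-- A fixed point P ↔ A(P) of a formula A modalized in x is unique: from □(P ↔ Q) one gets
-- A(P) ↔ A(Q), hence P ↔ Q, and Löb's rule removes the hypothesis.  It exists: D(x) ▷ E(x)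
-- has the de Jongh–Visser fixed point D(G) ▷ E(G), where G = □¬D(⊤) is the fixed point of
-- □¬D(x), and an implication A₁ → A₂ is reduced to smaller formulas by Bekič's elimination
-- with a fresh parameter.  An orderable system is solved by eliminating x₀, which is
-- modalized in every equation: its own equation has a fixed point H in the other variables,
-- substituting H for x₀ leaves a smaller orderable system, and its solutions extend by
-- x₀ := H.  Conversely, by uniqueness of fixed points every solution of the whole system
-- has x₀ ↔ H and restricts to a solution of the smaller one, which gives uniqueness.

module Submission where

open import Defs
open import Data.Bool using (Bool; true; false; not; _∨_; _∧_; T)
open import Data.Bool.Properties using (T-∧; T-≡)
import Data.Fin as Fin
open import Data.Fin using (Fin; toℕ)
open import Data.List using (List; []; _∷_; length; lookup)
open import Data.List.Membership.Propositional using (_∈_; _∉_)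
open import Data.List.Relation.Unary.Any using (here; there; index)
open import Data.List.Relation.Unary.Any.Properties using (lookup-index)
open import Data.List.Relation.Binary.Subset.Propositional using (_⊆_)
open import Data.List.Relation.Binary.Subset.Propositional.Properties
  using (⊆-refl; xs⊆x∷xs; ∈-∷⁺ʳ; ⊆-reflexive-↭)
open import Data.List.Relation.Binary.Permutation.Propositional using (↭-sym)
open import Data.Nat using (ℕ; zero; suc; _+_; _≤_; _≤?_; z≤n; s≤s)
open import Data.Nat.Properties
  using (_≟_; ≤-refl; ≤-trans; m≤m+n; m≤n+m; <⇒≢; >⇒≢; m+n≤o⇒m≤o; m+n≤o⇒n≤o)
open import Data.List.Membership.DecPropositional _≟_ using (_∈?_)
import Data.Product as Prod
open import Data.Product using (Σ; ∃; _×_; _,_; proj₁; proj₂)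
import Data.Sum as Sum
open import Data.Sum using (_⊎_; inj₁; inj₂)
open import Data.Unit using (⊤; tt)
import Data.Vec as Vec
open import Data.Vec using (Vec; []; _∷_)
open import Function using (_∘_)
open import Function.Bundles using (Equivalence)
open import Relation.Binary.PropositionalEquality
  using (_≡_; _≢_; refl; sym; trans; cong; cong₂; subst; subst₂)
open import Relation.Nullary using (¬_; yes; no; contradiction)
open import Relation.Nullary.Decidable using (True)

private variable
  n : ℕ
  x : Var
  A A′ B B′ C P Q X : Fm
  S S′ W : Var → Set
  L L′ : List Var
  φ ψ ρ ρ′ : Var → Fm

-- Tautologies

infixr 6 _⇒ₛ_
infix 7 _⇔ₛ_
infixr 8 _∨ₛ_
infixr 9 _∧ₛ_
infix 10 ¬ₛ_
infix 11 #_

-- Propositional steps are checked by truth tables: a schema over the variables # 0, # 1, …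
-- is instantiated by a vector of formulas.
data Schema (n : ℕ) : Set where
  at   : Fin n → Schema n
  ⊥ₛ   : Schema n
  _⇒ₛ_ : Schema n → Schema n → Schema n

#_ : ∀ m {n} {m<n : True (suc m ≤? n)} → Schema n
#_ m {m<n = m<n} = at (Fin.#_ m {m<n = m<n})

¬ₛ_ : Schema n → Schema n
¬ₛ a = a ⇒ₛ ⊥ₛ

_∨ₛ_ _∧ₛ_ _⇔ₛ_ : Schema n → Schema n → Schema n
a ∨ₛ b = ¬ₛ a ⇒ₛ b
a ∧ₛ b = ¬ₛ (a ⇒ₛ ¬ₛ b)
a ⇔ₛ b = (a ⇒ₛ b) ∧ₛ (b ⇒ₛ a)

⟦_⟧ : Schema n → Vec Fm n → Fm
⟦ at i ⟧ ρ = Vec.lookup ρ i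
⟦ ⊥ₛ ⟧ ρ = ⊥'
⟦ a ⇒ₛ b ⟧ ρ = ⟦ a ⟧ ρ ⇒ ⟦ b ⟧ ρ

truthValue : Schema n → Vec Bool n → Bool
truthValue (at i) b = Vec.lookup b i
truthValue ⊥ₛ b = false
truthValue (a ⇒ₛ c) b = not (truthValue a b) ∨ truthValue c b

holdsEverywhere : (n : ℕ) → (Vec Bool n → Bool) → Bool
holdsEverywhere zero f = f []
holdsEverywhere (suc n) f =
  holdsEverywhere n (λ b → f (true ∷ b)) ∧ holdsEverywhere n (λ b → f (false ∷ b))

holdsEverywhere-sound : ∀ n f → T (holdsEverywhere n f) → ∀ b → T (f b)
holdsEverywhere-sound zero f t [] = t
holdsEverywhere-sound (suc n) f t (true ∷ b) =
  holdsEverywhere-sound n _ (proj₁ (Equivalence.to T-∧ t)) b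
holdsEverywhere-sound (suc n) f t (false ∷ b) =
  holdsEverywhere-sound n _ (proj₂ (Equivalence.to (T-∧ {holdsEverywhere n f₁}) t)) b
  where
  f₁ : Vec Bool n → Bool
  f₁ b = f (true ∷ b)

valuation : (Fm → Bool) → Vec Fm n → Vec Bool n
valuation v [] = []
valuation v (A ∷ ρ) = eval v A ∷ valuation v ρ

eval-lookup : ∀ v (ρ : Vec Fm n) i → eval v (Vec.lookup ρ i) ≡ Vec.lookup (valuation v ρ) i
eval-lookup v (A ∷ ρ) Fin.zero = refl
eval-lookup v (A ∷ ρ) (Fin.suc i) = eval-lookup v ρ i

eval-⟦⟧ : ∀ v (a : Schema n) ρ → eval v (⟦ a ⟧ ρ) ≡ truthValue a (valuation v ρ)
eval-⟦⟧ v (at i) ρ = eval-lookup v ρ i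
eval-⟦⟧ v ⊥ₛ ρ = refl
eval-⟦⟧ v (a ⇒ₛ c) ρ = cong₂ (λ p q → not p ∨ q) (eval-⟦⟧ v a ρ) (eval-⟦⟧ v c ρ)

tautology : (a : Schema n) {_ : T (holdsEverywhere n (truthValue a))} (ρ : Vec Fm n) →
            IL⊢ (⟦ a ⟧ ρ)
tautology {n} a {valid} ρ = taut λ v →
  trans (eval-⟦⟧ v a ρ) (Equivalence.to T-≡ (holdsEverywhere-sound n _ valid (valuation v ρ)))

infixl 5 _·_
_·_ : IL⊢ (A ⇒ B) → IL⊢ A → IL⊢ B
_·_ = mp

-- Derived rules of IL

⊤' : Fm
⊤' = ¬' ⊥'

⇒-refl : IL⊢ (A ⇒ A)
⇒-refl {A} = tautology (# 0 ⇒ₛ # 0) (A ∷ [])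

⇒-trans : IL⊢ (A ⇒ B) → IL⊢ (B ⇒ C) → IL⊢ (A ⇒ C)
⇒-trans {A} {B} {C} h k =
  tautology ((# 0 ⇒ₛ # 1) ⇒ₛ (# 1 ⇒ₛ # 2) ⇒ₛ # 0 ⇒ₛ # 2) (A ∷ B ∷ C ∷ []) · h · k

contraposition : IL⊢ (A ⇒ B) → IL⊢ (¬' B ⇒ ¬' A)
contraposition {A} {B} h = tautology ((# 0 ⇒ₛ # 1) ⇒ₛ ¬ₛ # 1 ⇒ₛ ¬ₛ # 0) (A ∷ B ∷ []) · h

∧-intro : IL⊢ A → IL⊢ B → IL⊢ (A ∧' B)
∧-intro {A} {B} h k = tautology (# 0 ⇒ₛ # 1 ⇒ₛ # 0 ∧ₛ # 1) (A ∷ B ∷ []) · h · k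

⇔-intro : IL⊢ (A ⇒ B) → IL⊢ (B ⇒ A) → IL⊢ (A ⇔ B)
⇔-intro = ∧-intro

⇔-to : IL⊢ (A ⇔ B) → IL⊢ (A ⇒ B)
⇔-to {A} {B} h = tautology ((# 0 ⇔ₛ # 1) ⇒ₛ # 0 ⇒ₛ # 1) (A ∷ B ∷ []) · h

⇔-from : IL⊢ (A ⇔ B) → IL⊢ (B ⇒ A)
⇔-from {A} {B} h = tautology ((# 0 ⇔ₛ # 1) ⇒ₛ # 1 ⇒ₛ # 0) (A ∷ B ∷ []) · h

⇔-refl : IL⊢ (A ⇔ A)
⇔-refl = ⇔-intro ⇒-refl ⇒-refl

⇔-sym : IL⊢ (A ⇔ B) → IL⊢ (B ⇔ A)
⇔-sym h = ⇔-intro (⇔-from h) (⇔-to h)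

⇔-trans : IL⊢ (A ⇔ B) → IL⊢ (B ⇔ C) → IL⊢ (A ⇔ C)
⇔-trans h k = ⇔-intro (⇒-trans (⇔-to h) (⇔-to k)) (⇒-trans (⇔-from k) (⇔-from h))

⇒-cong : IL⊢ (A ⇔ A′) → IL⊢ (B ⇔ B′) → IL⊢ ((A ⇒ B) ⇔ (A′ ⇒ B′))
⇒-cong {A} {A′} {B} {B′} h k =
  tautology ((# 0 ⇔ₛ # 1) ⇒ₛ (# 2 ⇔ₛ # 3) ⇒ₛ ((# 0 ⇒ₛ # 2) ⇔ₛ (# 1 ⇒ₛ # 3))) (A ∷ A′ ∷ B ∷ B′ ∷ [])
    · h · k

⇒-cong-under : IL⊢ (P ⇒ (A ⇔ A′)) → IL⊢ (P ⇒ (B ⇔ B′)) → IL⊢ (P ⇒ ((A ⇒ B) ⇔ (A′ ⇒ B′)))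
⇒-cong-under {P} {A} {A′} {B} {B′} h k =
  tautology ((# 0 ⇒ₛ (# 1 ⇔ₛ # 2)) ⇒ₛ (# 0 ⇒ₛ (# 3 ⇔ₛ # 4))
             ⇒ₛ # 0 ⇒ₛ ((# 1 ⇒ₛ # 3) ⇔ₛ (# 2 ⇒ₛ # 4)))
    (P ∷ A ∷ A′ ∷ B ∷ B′ ∷ []) · h · k

⇒-⇔-refl : IL⊢ (P ⇒ (A ⇔ A))
⇒-⇔-refl {P} {A} = tautology (# 0 ⇒ₛ (# 1 ⇔ₛ # 1)) (P ∷ A ∷ [])

□-mono : IL⊢ (A ⇒ B) → IL⊢ (□ A ⇒ □ B)
□-mono {A} {B} h = axK A B · nec h

□-mono₂ : IL⊢ (A ⇒ B ⇒ C) → IL⊢ (□ A ⇒ □ B ⇒ □ C)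
□-mono₂ {A} {B} {C} h = ⇒-trans (□-mono h) (axK B C)

löb-rule : IL⊢ (□ A ⇒ A) → IL⊢ A
löb-rule {A} h = h · (axL A · nec h)

⊡ : Fm → Fm
⊡ X = X ∧' □ X

□⇒□⊡ : IL⊢ (□ X ⇒ □ (⊡ X))
□⇒□⊡ {X} =
  tautology ((# 0 ⇒ₛ # 1) ⇒ₛ (# 0 ⇒ₛ # 1 ⇒ₛ # 2) ⇒ₛ # 0 ⇒ₛ # 2) (□ X ∷ □ (□ X) ∷ □ (⊡ X) ∷ [])
    · ax4 X · □-mono₂ (tautology (# 0 ⇒ₛ # 1 ⇒ₛ # 0 ∧ₛ # 1) (X ∷ □ X ∷ []))

▷-mono□ : IL⊢ (□ (A′ ⇒ A) ⇒ □ (B ⇒ B′) ⇒ (A ▷ B) ⇒ (A′ ▷ B′))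
▷-mono□ {A′} {A} {B} {B′} =
  tautology ((# 0 ⇒ₛ # 4) ⇒ₛ (# 4 ∧ₛ # 2 ⇒ₛ # 5) ⇒ₛ (# 1 ⇒ₛ # 6) ⇒ₛ (# 5 ∧ₛ # 6 ⇒ₛ # 3)
             ⇒ₛ # 0 ⇒ₛ # 1 ⇒ₛ # 2 ⇒ₛ # 3)
    (□ (A′ ⇒ A) ∷ □ (B ⇒ B′) ∷ (A ▷ B) ∷ (A′ ▷ B′) ∷ (A′ ▷ A) ∷ (A′ ▷ B) ∷ (B ▷ B′) ∷ [])
    · axJ1 A′ A · axJ2 A′ A B · axJ1 B B′ · axJ2 A′ B B′

▷-monoˡ : IL⊢ (A′ ⇒ A) → IL⊢ ((A ▷ B) ⇒ (A′ ▷ B))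
▷-monoˡ h = ▷-mono□ · nec h · nec ⇒-refl

▷-monoʳ : IL⊢ (B ⇒ B′) → IL⊢ ((A ▷ B) ⇒ (A ▷ B′))
▷-monoʳ h = ▷-mono□ · nec ⇒-refl · nec h

▷-cong□ : IL⊢ (□ (A ⇔ A′) ⇒ □ (B ⇔ B′) ⇒ ((A ▷ B) ⇔ (A′ ▷ B′)))
▷-cong□ {A} {A′} {B} {B′} =
  tautology ((# 0 ⇒ₛ # 4) ⇒ₛ (# 1 ⇒ₛ # 5) ⇒ₛ (# 4 ⇒ₛ # 5 ⇒ₛ # 2 ⇒ₛ # 3)
             ⇒ₛ (# 0 ⇒ₛ # 6) ⇒ₛ (# 1 ⇒ₛ # 7) ⇒ₛ (# 6 ⇒ₛ # 7 ⇒ₛ # 3 ⇒ₛ # 2)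
             ⇒ₛ # 0 ⇒ₛ # 1 ⇒ₛ (# 2 ⇔ₛ # 3))
    (□ (A ⇔ A′) ∷ □ (B ⇔ B′) ∷ (A ▷ B) ∷ (A′ ▷ B′) ∷
     □ (A′ ⇒ A) ∷ □ (B ⇒ B′) ∷ □ (A ⇒ A′) ∷ □ (B′ ⇒ B) ∷ [])
    · □-mono (tautology ((# 0 ⇔ₛ # 1) ⇒ₛ # 1 ⇒ₛ # 0) (A ∷ A′ ∷ []))
    · □-mono (tautology ((# 0 ⇔ₛ # 1) ⇒ₛ # 0 ⇒ₛ # 1) (B ∷ B′ ∷ []))
    · ▷-mono□
    · □-mono (tautology ((# 0 ⇔ₛ # 1) ⇒ₛ # 0 ⇒ₛ # 1) (A ∷ A′ ∷ []))
    · □-mono (tautology ((# 0 ⇔ₛ # 1) ⇒ₛ # 1 ⇒ₛ # 0) (B ∷ B′ ∷ []))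
    · ▷-mono□

▷-cong : IL⊢ (A ⇔ A′) → IL⊢ (B ⇔ B′) → IL⊢ ((A ▷ B) ⇔ (A′ ▷ B′))
▷-cong h k = ▷-cong□ · nec h · nec k

▷-cong-under-□ : IL⊢ (⊡ X ⇒ (A ⇔ A′)) → IL⊢ (⊡ X ⇒ (B ⇔ B′)) →
                 IL⊢ (□ X ⇒ ((A ▷ B) ⇔ (A′ ▷ B′)))
▷-cong-under-□ {X} {A} {A′} {B} {B′} h k =
  tautology ((# 0 ⇒ₛ # 1) ⇒ₛ (# 1 ⇒ₛ # 2) ⇒ₛ (# 1 ⇒ₛ # 3) ⇒ₛ (# 2 ⇒ₛ # 3 ⇒ₛ # 4) ⇒ₛ # 0 ⇒ₛ # 4)
    (□ X ∷ □ (⊡ X) ∷ □ (A ⇔ A′) ∷ □ (B ⇔ B′) ∷ ((A ▷ B) ⇔ (A′ ▷ B′)) ∷ [])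
    · □⇒□⊡ · □-mono h · □-mono k · ▷-cong□

▷-trans : IL⊢ (A ▷ B) → IL⊢ (B ▷ C) → IL⊢ (A ▷ C)
▷-trans {A} {B} {C} h k = axJ2 A B C · ∧-intro h k

▷-precompose : IL⊢ (A ▷ B) → IL⊢ ((B ▷ C) ⇒ (A ▷ C))
▷-precompose {A} {B} {C} h =
  tautology (# 0 ⇒ₛ (# 0 ∧ₛ # 1 ⇒ₛ # 2) ⇒ₛ # 1 ⇒ₛ # 2) ((A ▷ B) ∷ (B ▷ C) ∷ (A ▷ C) ∷ [])
    · h · axJ2 A B C

▷-postcompose : IL⊢ (B ▷ C) → IL⊢ ((A ▷ B) ⇒ (A ▷ C))
▷-postcompose {B} {C} {A} h =
  tautology (# 1 ⇒ₛ (# 0 ∧ₛ # 1 ⇒ₛ # 2) ⇒ₛ # 0 ⇒ₛ # 2) ((A ▷ B) ∷ (B ▷ C) ∷ (A ▷ C) ∷ [])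
    · h · axJ2 A B C

◇-mono : IL⊢ (A ⇒ B) → IL⊢ (◇ A ⇒ ◇ B)
◇-mono {A} {B} h = axJ4 A B · (axJ1 A B · nec h)

◇◇⇒◇ : IL⊢ (◇ (◇ A) ⇒ ◇ A)
◇◇⇒◇ {A} = axJ4 (◇ A) A · axJ5 A

□¬⇒¬◇ : IL⊢ (□ (¬' A) ⇒ ¬' (◇ A))
□¬⇒¬◇ {A} =
  ⇒-trans (▷-monoˡ (tautology (# 0 ⇒ₛ ¬ₛ ¬ₛ # 0) (A ∷ [])))
          (tautology (# 0 ⇒ₛ ¬ₛ ¬ₛ # 0) ((A ▷ ⊥') ∷ []))

-- ¬' (□ Z) and ◇ (¬' Z) are the same formula.
löb-◇ : IL⊢ (¬' (□ (¬' A)) ⇒ ◇ (A ∧' □ (¬' A)))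
löb-◇ {A} =
  ⇒-trans (contraposition (axL (¬' A)))
          (◇-mono (tautology (¬ₛ (# 1 ⇒ₛ ¬ₛ # 0) ⇒ₛ # 0 ∧ₛ # 1) (A ∷ □ (¬' A) ∷ [])))

∨◇▷ : IL⊢ ((A ∨' ◇ A) ▷ A)
∨◇▷ {A} = axJ3 A (◇ A) A · ∧-intro (axJ1 A A · nec ⇒-refl) (axJ5 A)

▷-minimal : IL⊢ (A ▷ (A ∧' □ (¬' A)))
▷-minimal {A} = ▷-trans (axJ1 A (M ∨' ◇ M) · nec A⇒M∨◇M) ∨◇▷
  where
  M : Fm
  M = A ∧' □ (¬' A)
  A⇒M∨◇M : IL⊢ (A ⇒ (M ∨' ◇ M))
  A⇒M∨◇M = tautology ((¬ₛ # 1 ⇒ₛ # 2) ⇒ₛ # 0 ⇒ₛ (# 0 ∧ₛ # 1) ∨ₛ # 2) (A ∷ □ (¬' A) ∷ ◇ M ∷ [])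
             · löb-◇

▷-minimalˡ : IL⊢ ((A ▷ B) ⇔ ((A ∧' □ (¬' A)) ▷ B))
▷-minimalˡ {A} =
  ⇔-intro (▷-monoˡ (tautology (# 0 ∧ₛ # 1 ⇒ₛ # 0) (A ∷ □ (¬' A) ∷ []))) (▷-precompose ▷-minimal)

-- Substitution

_[_↦_] : (Var → Fm) → Var → Fm → Var → Fm
(σ [ x ↦ P ]) y with y ≟ x
... | yes _ = P
... | no _ = σ y

_≔_ : Var → Fm → Var → Fm
x ≔ P = var [ x ↦ P ]

[↦]-same : ∀ σ x P → (σ [ x ↦ P ]) x ≡ P
[↦]-same σ x P with x ≟ x
... | yes _ = refl
... | no x≢x = contradiction refl x≢x

[↦]-other : ∀ σ {x y} P → y ≢ x → (σ [ x ↦ P ]) y ≡ σ y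
[↦]-other σ {x} {y} P y≢x with y ≟ x
... | yes y≡x = contradiction y≡x y≢x
... | no _ = refl

[↦]-id : ∀ σ x y → (σ [ x ↦ σ x ]) y ≡ σ y
[↦]-id σ x y with y ≟ x
... | yes refl = refl
... | no _ = refl

[↦]-[↦] : ∀ σ x P Q y → ((σ [ x ↦ P ]) [ x ↦ Q ]) y ≡ (σ [ x ↦ Q ]) y
[↦]-[↦] σ x P Q y with y ≟ x
... | yes _ = refl
... | no y≢x = [↦]-other σ P y≢x

sub-∘ : ∀ σ τ A → sub σ (sub τ A) ≡ sub (sub σ ∘ τ) A
sub-∘ σ τ (var p) = refl
sub-∘ σ τ ⊥' = refl
sub-∘ σ τ (A ⇒ B) = cong₂ _⇒_ (sub-∘ σ τ A) (sub-∘ σ τ B)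
sub-∘ σ τ (A ▷ B) = cong₂ _▷_ (sub-∘ σ τ A) (sub-∘ σ τ B)

sub-cong : ∀ {σ τ} A → (∀ q → Occurs q A → σ q ≡ τ q) → sub σ A ≡ sub τ A
sub-cong (var p) h = h p here
sub-cong ⊥' h = refl
sub-cong (A ⇒ B) h = cong₂ _⇒_ (sub-cong A (λ q → h q ∘ ⇒ˡ)) (sub-cong B (λ q → h q ∘ ⇒ʳ))
sub-cong (A ▷ B) h = cong₂ _▷_ (sub-cong A (λ q → h q ∘ ▷ˡ)) (sub-cong B (λ q → h q ∘ ▷ʳ))

sub-id : ∀ A → sub var A ≡ A
sub-id (var p) = refl
sub-id ⊥' = refl
sub-id (A ⇒ B) = cong₂ _⇒_ (sub-id A) (sub-id B)
sub-id (A ▷ B) = cong₂ _▷_ (sub-id A) (sub-id B)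

Occurs-var : ∀ {p q} → Occurs p (var q) → p ≡ q
Occurs-var here = refl

sub-≔-unused : ¬ Occurs x A → sub (x ≔ P) A ≡ A
sub-≔-unused {x} {A} {P} x∉A =
  trans (sub-cong A (λ q q∈A → [↦]-other var P (λ q≡x → x∉A (subst (λ z → Occurs z A) q≡x q∈A))))
        (sub-id A)

sub-≔ : ∀ σ x P A → sub σ (sub (x ≔ P) A) ≡ sub (σ [ x ↦ sub σ P ]) A
sub-≔ σ x P A = trans (sub-∘ σ (x ≔ P) A) (sub-cong A (λ q _ → pointwise q))
  where
  pointwise : ∀ q → sub σ ((x ≔ P) q) ≡ (σ [ x ↦ sub σ P ]) q
  pointwise q with q ≟ x
  ... | yes _ = refl
  ... | no _ = refl

sub-≔-≔ : ∀ x P Q A → sub (x ≔ P) (sub (x ≔ Q) A) ≡ sub (x ≔ sub (x ≔ P) Q) A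
sub-≔-≔ x P Q A = trans (sub-≔ (x ≔ P) x Q A) (sub-cong A (λ q _ → [↦]-[↦] var x P _ q))

Occurs-sub : ∀ {q} σ A → Occurs q (sub σ A) → ∃ λ y → Occurs y A × Occurs q (σ y)
Occurs-sub σ (var p) o = p , here , o
Occurs-sub σ (A ⇒ B) (⇒ˡ o) = Prod.map₂ (Prod.map₁ ⇒ˡ) (Occurs-sub σ A o)
Occurs-sub σ (A ⇒ B) (⇒ʳ o) = Prod.map₂ (Prod.map₁ ⇒ʳ) (Occurs-sub σ B o)
Occurs-sub σ (A ▷ B) (▷ˡ o) = Prod.map₂ (Prod.map₁ ▷ˡ) (Occurs-sub σ A o)
Occurs-sub σ (A ▷ B) (▷ʳ o) = Prod.map₂ (Prod.map₁ ▷ʳ) (Occurs-sub σ B o)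

_∪｛_｝ : (Var → Set) → Var → Var → Set
(S ∪｛ x ｝) q = q ≡ x ⊎ S q

VocIn-mono : (∀ {q} → S q → S′ q) → VocIn A S → VocIn A S′
VocIn-mono f h q o = f (h q o)

VocIn-sub : ∀ σ → VocIn A S′ → (∀ q → S′ q → VocIn (σ q) S) → VocIn (sub σ A) S
VocIn-sub {A} σ hA hσ p o =
  let (y , y∈A , p∈σy) = Occurs-sub σ A o in hσ y (hA y y∈A) p p∈σy

VocIn-≔ : VocIn A (S ∪｛ x ｝) → VocIn P S → VocIn (sub (x ≔ P) A) S
VocIn-≔ {A} {S} {x} {P} hA hP = VocIn-sub (x ≔ P) hA voc-≔
  where
  voc-≔ : ∀ q → (S ∪｛ x ｝) q → VocIn ((x ≔ P) q) S
  voc-≔ q _ with q ≟ x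
  voc-≔ q _ | yes _ = hP
  voc-≔ q (inj₁ q≡x) | no q≢x = contradiction q≡x q≢x
  voc-≔ q (inj₂ q∈S) | no _ = λ { _ here → q∈S }

eval-sub : ∀ v σ A → eval v (sub σ A) ≡ eval (eval v ∘ sub σ) A
eval-sub v σ (var p) = refl
eval-sub v σ ⊥' = refl
eval-sub v σ (A ⇒ B) = cong₂ (λ a b → not a ∨ b) (eval-sub v σ A) (eval-sub v σ B)
eval-sub v σ (A ▷ B) = refl

⊢-sub : ∀ σ → IL⊢ A → IL⊢ (sub σ A)
⊢-sub σ (taut {A} t) = taut (λ v → trans (eval-sub v σ A) (t _))
⊢-sub σ (axK _ _) = axK _ _
⊢-sub σ (ax4 _) = ax4 _
⊢-sub σ (axL _) = axL _
⊢-sub σ (axJ1 _ _) = axJ1 _ _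
⊢-sub σ (axJ2 _ _ _) = axJ2 _ _ _
⊢-sub σ (axJ3 _ _ _) = axJ3 _ _ _
⊢-sub σ (axJ4 _ _) = axJ4 _ _
⊢-sub σ (axJ5 _) = axJ5 _
⊢-sub σ (mp h k) = ⊢-sub σ h · ⊢-sub σ k
⊢-sub σ (nec h) = nec (⊢-sub σ h)

sub-⇔ : ∀ σ τ A → (∀ q → Occurs q A → IL⊢ (σ q ⇔ τ q)) → IL⊢ (sub σ A ⇔ sub τ A)
sub-⇔ σ τ (var p) h = h p here
sub-⇔ σ τ ⊥' h = ⇔-refl
sub-⇔ σ τ (A ⇒ B) h = ⇒-cong (sub-⇔ σ τ A (λ q → h q ∘ ⇒ˡ)) (sub-⇔ σ τ B (λ q → h q ∘ ⇒ʳ))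
sub-⇔ σ τ (A ▷ B) h = ▷-cong (sub-⇔ σ τ A (λ q → h q ∘ ▷ˡ)) (sub-⇔ σ τ B (λ q → h q ∘ ▷ʳ))

≔-⇔-⊡ : ∀ x P Q A → IL⊢ (⊡ (P ⇔ Q) ⇒ (sub (x ≔ P) A ⇔ sub (x ≔ Q) A))
≔-⇔-⊡ x P Q (var y) with y ≟ x
... | yes _ = tautology ((# 0 ⇔ₛ # 1) ∧ₛ # 2 ⇒ₛ (# 0 ⇔ₛ # 1)) (P ∷ Q ∷ □ (P ⇔ Q) ∷ [])
... | no _ = ⇒-⇔-refl
≔-⇔-⊡ x P Q ⊥' = ⇒-⇔-refl
≔-⇔-⊡ x P Q (A ⇒ B) = ⇒-cong-under (≔-⇔-⊡ x P Q A) (≔-⇔-⊡ x P Q B)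
≔-⇔-⊡ x P Q (A ▷ B) =
  ⇒-trans (tautology (# 0 ∧ₛ # 1 ⇒ₛ # 1) ((P ⇔ Q) ∷ □ (P ⇔ Q) ∷ []))
          (▷-cong-under-□ (≔-⇔-⊡ x P Q A) (≔-⇔-⊡ x P Q B))

≔-⇔-□ : ∀ x P Q A → Modalized x A → IL⊢ (□ (P ⇔ Q) ⇒ (sub (x ≔ P) A ⇔ sub (x ≔ Q) A))
≔-⇔-□ x P Q (var y) y≢x rewrite [↦]-other var P y≢x | [↦]-other var Q y≢x = ⇒-⇔-refl
≔-⇔-□ x P Q ⊥' _ = ⇒-⇔-refl
≔-⇔-□ x P Q (A ⇒ B) (mA , mB) = ⇒-cong-under (≔-⇔-□ x P Q A mA) (≔-⇔-□ x P Q B mB)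
≔-⇔-□ x P Q (A ▷ B) _ = ▷-cong-under-□ (≔-⇔-⊡ x P Q A) (≔-⇔-⊡ x P Q B)

-- Fixed points

fixedPoint-unique : ∀ x A → Modalized x A →
  IL⊢ (P ⇔ sub (x ≔ P) A) → IL⊢ (Q ⇔ sub (x ≔ Q) A) → IL⊢ (P ⇔ Q)
fixedPoint-unique {P} {Q} x A m hP hQ = löb-rule
  (tautology ((# 0 ⇔ₛ # 2) ⇒ₛ (# 1 ⇔ₛ # 3) ⇒ₛ (# 4 ⇒ₛ (# 2 ⇔ₛ # 3)) ⇒ₛ # 4 ⇒ₛ (# 0 ⇔ₛ # 1))
     (P ∷ Q ∷ sub (x ≔ P) A ∷ sub (x ≔ Q) A ∷ □ (P ⇔ Q) ∷ [])
     · hP · hQ · ≔-⇔-□ x P Q A m)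

□-fixedPoint : ∀ x C → IL⊢ (□ (sub (x ≔ ⊤') C) ⇔ □ (sub (x ≔ □ (sub (x ≔ ⊤') C)) C))
□-fixedPoint x C = ⇔-intro G⇒□C[G] (löb-rule □[□C[G]⇒G]⇒□C[G]⇒G)
  where
  G C[G] : Fm
  G = □ (sub (x ≔ ⊤') C)
  C[G] = sub (x ≔ G) C
  □G⇒[□C[G]⇔G] : IL⊢ (□ G ⇒ (□ C[G] ⇔ G))
  □G⇒[□C[G]⇔G] =
    ⇒-trans (□-mono (tautology (# 0 ⇒ₛ (# 0 ⇔ₛ ¬ₛ ⊥ₛ)) (G ∷ []))) (≔-⇔-□ x G ⊤' (□ C) tt)
  G⇒□C[G] : IL⊢ (G ⇒ □ C[G])
  G⇒□C[G] =
    tautology ((# 0 ⇒ₛ # 1) ⇒ₛ (# 1 ⇒ₛ (# 2 ⇔ₛ # 0)) ⇒ₛ # 0 ⇒ₛ # 2) (G ∷ □ G ∷ □ C[G] ∷ [])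
      · ax4 (sub (x ≔ ⊤') C) · □G⇒[□C[G]⇔G]
  □[□C[G]⇒G]⇒□C[G]⇒G : IL⊢ (□ (□ C[G] ⇒ G) ⇒ □ C[G] ⇒ G)
  □[□C[G]⇒G]⇒□C[G]⇒G =
    tautology ((# 1 ⇒ₛ # 2) ⇒ₛ (# 0 ⇒ₛ # 2 ⇒ₛ # 3) ⇒ₛ (# 3 ⇒ₛ (# 1 ⇔ₛ # 4)) ⇒ₛ # 0 ⇒ₛ # 1 ⇒ₛ # 4)
      (□ (□ C[G] ⇒ G) ∷ □ C[G] ∷ □ (□ C[G]) ∷ □ G ∷ G ∷ [])
      · ax4 C[G] · axK (□ C[G]) G · □G⇒[□C[G]⇔G]

module DeJonghVisser (x : Var) (D E : Fm) where
  D[_] E[_] : Fm → Fm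
  D[ Y ] = sub (x ≔ Y) D
  E[ Y ] = sub (x ≔ Y) E

  G K M : Fm
  G = □ (¬' D[ ⊤' ])
  K = D[ G ] ▷ E[ G ]
  M = D[ G ] ∧' □ (¬' D[ G ])

  G⇔□¬D[G] : IL⊢ (G ⇔ □ (¬' D[ G ]))
  G⇔□¬D[G] = □-fixedPoint x (¬' D)

  □¬D[G]⇒K : IL⊢ (□ (¬' D[ G ]) ⇒ K)
  □¬D[G]⇒K = ⇒-trans (axJ1 D[ G ] ⊥') (▷-monoʳ (tautology (⊥ₛ ⇒ₛ # 0) (E[ G ] ∷ [])))

  G⇒K : IL⊢ (G ⇒ K)
  G⇒K = ⇒-trans (⇔-to G⇔□¬D[G]) □¬D[G]⇒K

  □¬D[G]⇒⊡[K⇔G] : IL⊢ (□ (¬' D[ G ]) ⇒ ⊡ (K ⇔ G))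
  □¬D[G]⇒⊡[K⇔G] =
    tautology ((# 0 ⇒ₛ # 1) ⇒ₛ (# 2 ⇒ₛ # 3) ⇒ₛ (# 0 ⇒ₛ # 2) ⇒ₛ # 0 ⇒ₛ # 1 ∧ₛ # 3)
      (□ (¬' D[ G ]) ∷ (K ⇔ G) ∷ □ (□ (¬' D[ G ])) ∷ □ (K ⇔ G) ∷ [])
      · □¬D[G]⇒[K⇔G] · □-mono □¬D[G]⇒[K⇔G] · ax4 (¬' D[ G ])
    where
    □¬D[G]⇒[K⇔G] : IL⊢ (□ (¬' D[ G ]) ⇒ (K ⇔ G))
    □¬D[G]⇒[K⇔G] =
      tautology ((# 0 ⇒ₛ # 1) ⇒ₛ (# 0 ⇒ₛ # 2) ⇒ₛ # 0 ⇒ₛ (# 1 ⇔ₛ # 2)) (□ (¬' D[ G ]) ∷ K ∷ G ∷ [])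
        · □¬D[G]⇒K · ⇔-from G⇔□¬D[G]

  □¬D[G]⇒[D[K]⇔D[G]] : IL⊢ (□ (¬' D[ G ]) ⇒ (D[ K ] ⇔ D[ G ]))
  □¬D[G]⇒[D[K]⇔D[G]] = ⇒-trans □¬D[G]⇒⊡[K⇔G] (≔-⇔-⊡ x K G D)

  □¬D[K]⇒□¬D[G] : IL⊢ (□ (¬' D[ K ]) ⇒ □ (¬' D[ G ]))
  □¬D[K]⇒□¬D[G] = löb-rule
    (tautology ((# 1 ⇒ₛ # 2) ⇒ₛ (# 0 ⇒ₛ # 2 ⇒ₛ # 3) ⇒ₛ (# 3 ⇒ₛ # 4) ⇒ₛ (# 4 ⇒ₛ # 1 ⇒ₛ # 5)
                ⇒ₛ # 0 ⇒ₛ # 1 ⇒ₛ # 5)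
       (□ (□ (¬' D[ K ]) ⇒ □ (¬' D[ G ])) ∷ □ (¬' D[ K ]) ∷ □ (□ (¬' D[ K ])) ∷
        □ (□ (¬' D[ G ])) ∷ □ (D[ K ] ⇔ D[ G ]) ∷ □ (¬' D[ G ]) ∷ [])
       · ax4 (¬' D[ K ]) · axK (□ (¬' D[ K ])) (□ (¬' D[ G ])) · □-mono □¬D[G]⇒[D[K]⇔D[G]]
       · □-mono₂ (tautology ((# 0 ⇔ₛ # 1) ⇒ₛ ¬ₛ # 0 ⇒ₛ ¬ₛ # 1) (D[ K ] ∷ D[ G ] ∷ [])))

  □¬D[G]⇒□¬D[K] : IL⊢ (□ (¬' D[ G ]) ⇒ □ (¬' D[ K ]))
  □¬D[G]⇒□¬D[K] =
    tautology ((# 0 ⇒ₛ # 1) ⇒ₛ (# 1 ⇒ₛ # 2) ⇒ₛ (# 2 ⇒ₛ # 0 ⇒ₛ # 3) ⇒ₛ # 0 ⇒ₛ # 3)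
      (□ (¬' D[ G ]) ∷ □ (□ (¬' D[ G ])) ∷ □ (D[ K ] ⇔ D[ G ]) ∷ □ (¬' D[ K ]) ∷ [])
      · ax4 (¬' D[ G ]) · □-mono □¬D[G]⇒[D[K]⇔D[G]]
      · □-mono₂ (tautology ((# 0 ⇔ₛ # 1) ⇒ₛ ¬ₛ # 1 ⇒ₛ ¬ₛ # 0) (D[ K ] ∷ D[ G ] ∷ []))

  D[K]∧□¬D[K]⇔M : IL⊢ ((D[ K ] ∧' □ (¬' D[ K ])) ⇔ M)
  D[K]∧□¬D[K]⇔M =
    tautology ((# 1 ⇒ₛ # 3) ⇒ₛ (# 3 ⇒ₛ # 1) ⇒ₛ (# 3 ⇒ₛ (# 0 ⇔ₛ # 2)) ⇒ₛ (# 0 ∧ₛ # 1 ⇔ₛ # 2 ∧ₛ # 3))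
      (D[ K ] ∷ □ (¬' D[ K ]) ∷ D[ G ] ∷ □ (¬' D[ G ]) ∷ [])
      · □¬D[K]⇒□¬D[G] · □¬D[G]⇒□¬D[K] · □¬D[G]⇒[D[K]⇔D[G]]

  K⇔M▷E[G] : IL⊢ (K ⇔ (M ▷ E[ G ]))
  K⇔M▷E[G] = ▷-minimalˡ

  K∧¬G⇒◇E[G] : IL⊢ ((K ∧' ¬' G) ⇒ ◇ E[ G ])
  K∧¬G⇒◇E[G] =
    tautology ((# 0 ⇒ₛ # 2) ⇒ₛ (¬ₛ # 1 ⇒ₛ # 3) ⇒ₛ (# 2 ⇒ₛ # 3 ⇒ₛ # 4) ⇒ₛ # 0 ∧ₛ ¬ₛ # 1 ⇒ₛ # 4)
      (K ∷ G ∷ (M ▷ E[ G ]) ∷ ◇ M ∷ ◇ E[ G ] ∷ [])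
      · ⇔-to K⇔M▷E[G] · ⇒-trans (contraposition (⇔-from G⇔□¬D[G])) löb-◇ · axJ4 M E[ G ]

  ¬⊡[K⇔G]⇒◇E[G] : IL⊢ (¬' (⊡ (K ⇔ G)) ⇒ ◇ E[ G ])
  ¬⊡[K⇔G]⇒◇E[G] =
    tautology ((¬ₛ # 0 ⇒ₛ # 2) ⇒ₛ (¬ₛ # 1 ⇒ₛ # 2) ⇒ₛ ¬ₛ (# 0 ∧ₛ # 1) ⇒ₛ # 2)
      ((K ⇔ G) ∷ □ (K ⇔ G) ∷ ◇ E[ G ] ∷ [])
      · ¬[K⇔G]⇒◇E[G] · ⇒-trans (◇-mono ¬[K⇔G]⇒◇E[G]) ◇◇⇒◇
    where
    ¬[K⇔G]⇒◇E[G] : IL⊢ (¬' (K ⇔ G) ⇒ ◇ E[ G ])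
    ¬[K⇔G]⇒◇E[G] =
      ⇒-trans (tautology ((# 1 ⇒ₛ # 0) ⇒ₛ ¬ₛ (# 0 ⇔ₛ # 1) ⇒ₛ # 0 ∧ₛ ¬ₛ # 1) (K ∷ G ∷ []) · G⇒K)
              K∧¬G⇒◇E[G]

  E[K]⇒E[G]∨◇E[G] : IL⊢ (E[ K ] ⇒ (E[ G ] ∨' ◇ E[ G ]))
  E[K]⇒E[G]∨◇E[G] =
    tautology ((# 0 ⇒ₛ (# 1 ⇔ₛ # 2)) ⇒ₛ (¬ₛ # 0 ⇒ₛ # 3) ⇒ₛ # 1 ⇒ₛ # 2 ∨ₛ # 3)
      (⊡ (K ⇔ G) ∷ E[ K ] ∷ E[ G ] ∷ ◇ E[ G ] ∷ [])
      · ≔-⇔-⊡ x K G E · ¬⊡[K⇔G]⇒◇E[G]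

  E[G]∧□¬E[G]⇒E[K] : IL⊢ ((E[ G ] ∧' □ (¬' E[ G ])) ⇒ E[ K ])
  E[G]∧□¬E[G]⇒E[K] =
    tautology ((# 0 ⇒ₛ (# 1 ⇔ₛ # 2)) ⇒ₛ (¬ₛ # 0 ⇒ₛ # 3) ⇒ₛ (# 4 ⇒ₛ ¬ₛ # 3) ⇒ₛ # 2 ∧ₛ # 4 ⇒ₛ # 1)
      (⊡ (K ⇔ G) ∷ E[ K ] ∷ E[ G ] ∷ ◇ E[ G ] ∷ □ (¬' E[ G ]) ∷ [])
      · ≔-⇔-⊡ x K G E · ¬⊡[K⇔G]⇒◇E[G] · □¬⇒¬◇

  K-fixed : IL⊢ (K ⇔ (D[ K ] ▷ E[ K ]))
  K-fixed =
    ⇔-trans (⇔-intro K⇒M▷E[K] M▷E[K]⇒K) (⇔-sym (⇔-trans ▷-minimalˡ (▷-cong D[K]∧□¬D[K]⇔M ⇔-refl)))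
    where
    K⇒M▷E[K] : IL⊢ (K ⇒ (M ▷ E[ K ]))
    K⇒M▷E[K] =
      ⇒-trans (⇔-to K⇔M▷E[G]) (⇒-trans (▷-postcompose ▷-minimal) (▷-monoʳ E[G]∧□¬E[G]⇒E[K]))
    M▷E[K]⇒K : IL⊢ ((M ▷ E[ K ]) ⇒ K)
    M▷E[K]⇒K =
      ⇒-trans (▷-monoʳ E[K]⇒E[G]∨◇E[G]) (⇒-trans (▷-postcompose ∨◇▷) (⇔-from K⇔M▷E[G]))

record FixedPoint (x : Var) (A : Fm) : Set₁ where
  field
    point : Fm
    point-voc : VocIn A (S ∪｛ x ｝) → VocIn point S
    point-fixed : IL⊢ (point ⇔ sub (x ≔ point) A)

open FixedPoint

var-fixedPoint : ∀ {q} → q ≢ x → FixedPoint x (var q)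
var-fixedPoint {x} {q} q≢x = record
  { point = var q
  ; point-voc = λ h → λ { _ here → Sum.[ (λ q≡x → contradiction q≡x q≢x) , (λ s → s) ]′ (h q here) }
  ; point-fixed = subst (λ F → IL⊢ (var q ⇔ F)) (sym ([↦]-other var (var q) q≢x)) ⇔-refl
  }

⊥-fixedPoint : FixedPoint x ⊥'
⊥-fixedPoint = record { point = ⊥' ; point-voc = λ _ _ () ; point-fixed = ⇔-refl }

VocIn-⊤' : VocIn ⊤' S
VocIn-⊤' _ (⇒ˡ ())
VocIn-⊤' _ (⇒ʳ ())

VocIn-□¬ : VocIn A S → VocIn (□ (¬' A)) S
VocIn-□¬ h q (▷ˡ (⇒ˡ (⇒ˡ o))) = h q o
VocIn-□¬ h q (▷ˡ (⇒ˡ (⇒ʳ ())))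
VocIn-□¬ h q (▷ˡ (⇒ʳ ()))
VocIn-□¬ h q (▷ʳ ())

▷-fixedPoint : ∀ x D E → FixedPoint x (D ▷ E)
▷-fixedPoint x D E = record
  { point = K
  ; point-voc = λ h → VocIn-≔ h (VocIn-≔ (VocIn-□¬ (λ q → h q ∘ ▷ˡ)) VocIn-⊤')
  ; point-fixed = K-fixed
  }
  where open DeJonghVisser x D E

Modalized-sub : ∀ {r} σ A → (∀ q → Modalized q A ⊎ Modalized r (σ q)) → Modalized r (sub σ A)
Modalized-sub σ (var p) h = Sum.[ (λ p≢p → contradiction refl p≢p) , (λ m → m) ]′ (h p)
Modalized-sub σ ⊥' h = tt
Modalized-sub σ (A ⇒ B) h =
  Modalized-sub σ A (Sum.map₁ proj₁ ∘ h) , Modalized-sub σ B (Sum.map₁ proj₂ ∘ h)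
Modalized-sub σ (A ▷ B) h = tt

Modalized-≔ : ∀ {z} x P A → Modalized z A → Modalized x A → Modalized z (sub (x ≔ P) A)
Modalized-≔ {z} x P A mz mx = Modalized-sub (x ≔ P) A modalized-or-kept
  where
  modalized-or-kept : ∀ q → Modalized q A ⊎ Modalized z ((x ≔ P) q)
  modalized-or-kept q with q ≟ x | q ≟ z
  ... | yes refl | _ = inj₁ mx
  ... | no _ | yes refl = inj₁ mz
  ... | no _ | no q≢z = inj₂ q≢z

¬Occurs⇒Modalized : ∀ A → ¬ Occurs x A → Modalized x A
¬Occurs⇒Modalized (var q) x∉A q≡x = x∉A (subst (λ z → Occurs _ (var z)) (sym q≡x) here)
¬Occurs⇒Modalized ⊥' _ = tt
¬Occurs⇒Modalized (A ⇒ B) x∉A = ¬Occurs⇒Modalized A (x∉A ∘ ⇒ˡ) , ¬Occurs⇒Modalized B (x∉A ∘ ⇒ʳ)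
¬Occurs⇒Modalized (A ▷ B) _ = tt

-- Replacing x by r ⇒ x in A₂ makes its fixed point H₂ depend on a parameter r that stands
-- for the antecedent; r is then fixed by H₁.
module Bekič {x r : Var} {A₁ A₂ : Fm}
  (r≢x : r ≢ x) (r-fresh : ∀ {q} → Occurs q (A₁ ⇒ A₂) → q ≢ r)
  (fp₂ : FixedPoint x (sub (x ≔ (var r ⇒ var x)) A₂))
  (fp₁ : FixedPoint r (sub (x ≔ (var r ⇒ point fp₂)) A₁)) where

  H₁ H₂ H : Fm
  H₁ = point fp₁
  H₂ = point fp₂
  H = H₁ ⇒ sub (r ≔ H₁) H₂

  r≔H₁-after-x≔ : ∀ A → (∀ {q} → Occurs q A → q ≢ r) →
                  sub (r ≔ H₁) (sub (x ≔ (var r ⇒ H₂)) A) ≡ sub (x ≔ H) A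
  r≔H₁-after-x≔ A r∉A =
    trans (sub-≔ (r ≔ H₁) x (var r ⇒ H₂) A) (sub-cong A (λ q → pointwise q ∘ r∉A))
    where
    pointwise : ∀ q → q ≢ r → ((r ≔ H₁) [ x ↦ sub (r ≔ H₁) (var r ⇒ H₂) ]) q ≡ (x ≔ H) q
    pointwise q q≢r with q ≟ x
    ... | yes _ = cong (_⇒ sub (r ≔ H₁) H₂) ([↦]-same var r H₁)
    ... | no _ = [↦]-other var H₁ q≢r

  H₁-fixed : IL⊢ (H₁ ⇔ sub (x ≔ H) A₁)
  H₁-fixed = subst (λ F → IL⊢ (H₁ ⇔ F)) (r≔H₁-after-x≔ A₁ (r-fresh ∘ ⇒ˡ)) (point-fixed fp₁)

  H₂[H₁]-fixed : IL⊢ (sub (r ≔ H₁) H₂ ⇔ sub (x ≔ H) A₂)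
  H₂[H₁]-fixed = subst (λ F → IL⊢ (sub (r ≔ H₁) H₂ ⇔ F)) (r≔H₁-after-x≔ A₂ (r-fresh ∘ ⇒ʳ))
    (⊢-sub (r ≔ H₁) (subst (λ F → IL⊢ (H₂ ⇔ F)) H₂-unfolds (point-fixed fp₂)))
    where
    H₂-unfolds : sub (x ≔ H₂) (sub (x ≔ (var r ⇒ var x)) A₂) ≡ sub (x ≔ (var r ⇒ H₂)) A₂
    H₂-unfolds = trans (sub-≔-≔ x H₂ (var r ⇒ var x) A₂)
      (cong (λ F → sub (x ≔ F) A₂) (cong₂ _⇒_ ([↦]-other var H₂ r≢x) ([↦]-same var x H₂)))

  H-voc : VocIn (A₁ ⇒ A₂) (S ∪｛ x ｝) → VocIn H S
  H-voc {S} h = λ { q (⇒ˡ o) → H₁-voc q o ; q (⇒ʳ o) → VocIn-≔ H₂-voc H₁-voc q o }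
    where
    H₂-voc : VocIn H₂ (S ∪｛ r ｝)
    H₂-voc = point-voc fp₂
      (VocIn-≔ (VocIn-mono (Sum.map₂ (inj₂ ∘ inj₂)) (λ q → h q ∘ ⇒ʳ))
               (λ { _ (⇒ˡ here) → inj₂ (inj₁ refl) ; _ (⇒ʳ here) → inj₁ refl }))
    H₁-voc : VocIn H₁ S
    H₁-voc = point-voc fp₁
      (VocIn-≔ (VocIn-mono (Sum.map₂ inj₂) (λ q → h q ∘ ⇒ˡ))
               (λ { _ (⇒ˡ here) → inj₁ refl ; q (⇒ʳ o) → H₂-voc q o }))

  fixedPoint : FixedPoint x (A₁ ⇒ A₂)
  fixedPoint = record { point = H ; point-voc = H-voc ; point-fixed = ⇒-cong H₁-fixed H₂[H₁]-fixed }

outerSize : Fm → ℕ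
outerSize (var _) = 1
outerSize ⊥' = 1
outerSize (A ⇒ B) = suc (outerSize A + outerSize B)
outerSize (_ ▷ _) = 1

outerSize-≔ : ∀ x P A → Modalized x A → outerSize (sub (x ≔ P) A) ≡ outerSize A
outerSize-≔ x P (var q) q≢x rewrite [↦]-other var P q≢x = refl
outerSize-≔ x P ⊥' _ = refl
outerSize-≔ x P (A ⇒ B) (mA , mB) =
  cong₂ (λ a b → suc (a + b)) (outerSize-≔ x P A mA) (outerSize-≔ x P B mB)
outerSize-≔ x P (A ▷ B) _ = refl

varBound : Fm → ℕ
varBound (var p) = p
varBound ⊥' = 0
varBound (A ⇒ B) = varBound A + varBound B
varBound (A ▷ B) = varBound A + varBound B

Occurs⇒≤varBound : ∀ {q} A → Occurs q A → q ≤ varBound A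
Occurs⇒≤varBound (var p) here = ≤-refl
Occurs⇒≤varBound (A ⇒ B) (⇒ˡ o) = ≤-trans (Occurs⇒≤varBound A o) (m≤m+n _ _)
Occurs⇒≤varBound (A ⇒ B) (⇒ʳ o) = ≤-trans (Occurs⇒≤varBound B o) (m≤n+m _ _)
Occurs⇒≤varBound (A ▷ B) (▷ˡ o) = ≤-trans (Occurs⇒≤varBound A o) (m≤m+n _ _)
Occurs⇒≤varBound (A ▷ B) (▷ʳ o) = ≤-trans (Occurs⇒≤varBound B o) (m≤n+m _ _)

fresh : Fm → Var → Var
fresh A x = suc (varBound A + x)

fresh-≢ : ∀ A x → fresh A x ≢ x
fresh-≢ A x = >⇒≢ (s≤s (m≤n+m x (varBound A)))

fresh-∉ : ∀ A x {q} → Occurs q A → q ≢ fresh A x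
fresh-∉ A x o = <⇒≢ (s≤s (≤-trans (Occurs⇒≤varBound A o) (m≤m+n _ _)))

fixedPoint≤ : ∀ n x A → outerSize A ≤ n → Modalized x A → FixedPoint x A
fixedPoint≤ _ x (var q) _ q≢x = var-fixedPoint q≢x
fixedPoint≤ _ x ⊥' _ _ = ⊥-fixedPoint
fixedPoint≤ _ x (D ▷ E) _ _ = ▷-fixedPoint x D E
fixedPoint≤ (suc n) x (A₁ ⇒ A₂) (s≤s size) (m₁ , m₂) =
  Bekič.fixedPoint (fresh-≢ (A₁ ⇒ A₂) x) (fresh-∉ (A₁ ⇒ A₂) x) fp₂ fp₁
  where
  r : Var
  r = fresh (A₁ ⇒ A₂) x
  fp₂ : FixedPoint x (sub (x ≔ (var r ⇒ var x)) A₂)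
  fp₂ = fixedPoint≤ n x _
    (subst (_≤ n) (sym (outerSize-≔ x _ A₂ m₂)) (m+n≤o⇒n≤o (outerSize A₁) size))
    (Modalized-≔ x _ A₂ m₂ m₂)
  fp₁ : FixedPoint r (sub (x ≔ (var r ⇒ point fp₂)) A₁)
  fp₁ = fixedPoint≤ n r _
    (subst (_≤ n) (sym (outerSize-≔ x _ A₁ m₁)) (m+n≤o⇒m≤o (outerSize A₁) size))
    (Modalized-≔ x _ A₁ (¬Occurs⇒Modalized A₁ (λ o → fresh-∉ (A₁ ⇒ A₂) x (⇒ˡ o) refl)) m₁)

fixedPoint : Modalized x A → FixedPoint x A
fixedPoint {x} {A} = fixedPoint≤ (outerSize A) x A ≤-refl

-- Orderable systems

Ordered : List Var → (Var → Fm) → Set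
Ordered [] φ = ⊤
Ordered (x ∷ L) φ = (∀ {y} → y ∈ x ∷ L → Modalized x (φ y)) × Ordered L φ

Ordered-fromIndices : ∀ L {φ} →
  ((i j : Fin (length L)) → toℕ i ≤ toℕ j → Modalized (lookup L i) (φ (lookup L j))) → Ordered L φ
Ordered-fromIndices [] _ = tt
Ordered-fromIndices (x ∷ L) {φ} h =
  (λ y∈ → subst (λ z → Modalized x (φ z)) (sym (lookup-index y∈)) (h Fin.zero (index y∈) z≤n)) ,
  Ordered-fromIndices L (λ i j i≤j → h (Fin.suc i) (Fin.suc j) (s≤s i≤j))

Ordered-≔ : ∀ {x} P L {φ} → (∀ {y} → y ∈ L → Modalized x (φ y)) → Ordered L φ →
            Ordered L (λ y → sub (x ≔ P) (φ y))
Ordered-≔ P [] _ _ = tt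
Ordered-≔ {x} P (z ∷ L) {φ} mx (mz , ord) =
  (λ {y} y∈ → Modalized-≔ x P (φ y) (mz y∈) (mx y∈)) , Ordered-≔ P L (mx ∘ there) ord

SystemOver : List Var → (Var → Set) → (Var → Fm) → Set
SystemOver L W φ = ∀ x → x ∈ L → VocIn (φ x) (λ p → p ∈ L ⊎ W p)

record Solves (L : List Var) (W : Var → Set) (φ ρ : Var → Fm) : Set where
  field
    outside : ∀ {y} → y ∉ L → ρ y ≡ var y
    voc : ∀ {x} → x ∈ L → VocIn (ρ x) W
    equation : ∀ {x} → x ∈ L → IL⊢ (ρ x ⇔ sub ρ (φ x))

open Solves

SystemOver-resp : L ⊆ L′ → L′ ⊆ L → SystemOver L W φ → SystemOver L′ W φ
SystemOver-resp L⊆L′ L′⊆L sys x x∈L′ = VocIn-mono (Sum.map₁ L⊆L′) (sys x (L′⊆L x∈L′))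

Solves-resp : L ⊆ L′ → L′ ⊆ L → Solves L W φ ρ → Solves L′ W φ ρ
Solves-resp L⊆L′ L′⊆L s = record
  { outside = λ y∉L′ → outside s (y∉L′ ∘ L⊆L′)
  ; voc = voc s ∘ L′⊆L
  ; equation = equation s ∘ L′⊆L
  }

Solves-voc-sub : Solves L W φ ρ → VocIn A (λ p → p ∈ L ⊎ W p) → VocIn (sub ρ A) W
Solves-voc-sub {L} {W} {ρ = ρ} s hA = VocIn-sub ρ hA voc-ρ
  where
  voc-ρ : ∀ q → q ∈ L ⊎ W q → VocIn (ρ q) W
  voc-ρ q (inj₁ q∈L) = voc s q∈L
  voc-ρ q (inj₂ q∈W) with q ∈? L
  ... | yes q∈L = voc s q∈L
  ... | no q∉L rewrite outside s q∉L = λ { _ here → q∈W }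

Solves-⇔ : Solves L W φ ρ → Solves L W ψ ρ′ → (∀ {y} → y ∈ L → IL⊢ (ρ y ⇔ ρ′ y)) →
           ∀ q → IL⊢ (ρ q ⇔ ρ′ q)
Solves-⇔ {L} s s′ agree q with q ∈? L
... | yes q∈L = agree q∈L
... | no q∉L rewrite outside s q∉L | outside s′ q∉L = ⇔-refl

VocIn-∷ : VocIn A (λ p → p ∈ x ∷ L ⊎ W p) → VocIn A ((λ p → p ∈ L ⊎ W p) ∪｛ x ｝)
VocIn-∷ = VocIn-mono λ { (inj₁ (here p≡x)) → inj₁ p≡x ; (inj₁ (there p∈L)) → inj₂ (inj₁ p∈L)
                       ; (inj₂ p∈W) → inj₂ (inj₂ p∈W) }

module Elimination {W : Var → Set} {x : Var} {L : List Var} {φ : Var → Fm}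
  (x∉L : x ∉ L) (x∉W : ¬ W x) (system : SystemOver (x ∷ L) W φ)
  (modalized : ∀ {y} → y ∈ x ∷ L → Modalized x (φ y)) where

  fp : FixedPoint x (φ x)
  fp = fixedPoint (modalized (here refl))

  H : Fm
  H = point fp

  H-fixed : IL⊢ (H ⇔ sub (x ≔ H) (φ x))
  H-fixed = point-fixed fp

  H-voc : VocIn H (λ p → p ∈ L ⊎ W p)
  H-voc = point-voc fp (VocIn-∷ (system x (here refl)))

  φ′ : Var → Fm
  φ′ y = sub (x ≔ H) (φ y)

  φ′-system : SystemOver L W φ′
  φ′-system y y∈L = VocIn-≔ (VocIn-∷ (system y (there y∈L))) H-voc

  φ′-ordered : Ordered L φ → Ordered L φ′
  φ′-ordered = Ordered-≔ H L (modalized ∘ there)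

  ∈L⇒≢x : ∀ {y} → y ∈ L → y ≢ x
  ∈L⇒≢x y∈L y≡x = x∉L (subst (_∈ L) y≡x y∈L)

  extend : ∀ {ρ′} → Solves L W φ′ ρ′ → Solves (x ∷ L) W φ (ρ′ [ x ↦ sub ρ′ H ])
  extend {ρ′} s = record { outside = outside′ ; voc = voc′ ; equation = equation′ }
    where
    σ : Var → Fm
    σ = ρ′ [ x ↦ sub ρ′ H ]
    σ-on-L : ∀ {y} → y ∈ L → σ y ≡ ρ′ y
    σ-on-L = [↦]-other ρ′ (sub ρ′ H) ∘ ∈L⇒≢x
    outside′ : ∀ {y} → y ∉ x ∷ L → σ y ≡ var y
    outside′ y∉ = trans ([↦]-other ρ′ (sub ρ′ H) (y∉ ∘ here)) (outside s (y∉ ∘ there))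
    voc′ : ∀ {y} → y ∈ x ∷ L → VocIn (σ y) W
    voc′ (here refl) rewrite [↦]-same ρ′ x (sub ρ′ H) = Solves-voc-sub s H-voc
    voc′ (there y∈L) rewrite σ-on-L y∈L = voc s y∈L
    equation′ : ∀ {y} → y ∈ x ∷ L → IL⊢ (σ y ⇔ sub σ (φ y))
    equation′ (here refl) rewrite [↦]-same ρ′ x (sub ρ′ H) | sym (sub-≔ ρ′ x H (φ x)) =
      ⊢-sub ρ′ H-fixed
    equation′ {y} (there y∈L) rewrite σ-on-L y∈L | sym (sub-≔ ρ′ x H (φ y)) =
      equation s y∈L

  module Restriction {ρ : Var → Fm} (s : Solves (x ∷ L) W φ ρ) where
    ρ₀ : Var → Fm
    ρ₀ = ρ [ x ↦ var x ]

    K₀ : Fm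
    K₀ = sub ρ₀ H

    x∉ρ : ∀ {q} → q ≢ x → ¬ Occurs x (ρ q)
    x∉ρ {q} q≢x x∈ρq with q ∈? L
    ... | yes q∈L = x∉W (voc s (there q∈L) x x∈ρq)
    ... | no q∉L = q≢x (sym (Occurs-var (subst (Occurs x) (outside s q∉x∷L) x∈ρq)))
      where
      q∉x∷L : q ∉ x ∷ L
      q∉x∷L (here q≡x) = q≢x q≡x
      q∉x∷L (there q∈L) = q∉L q∈L

    ≔-after-ρ₀ : ∀ P q → sub (x ≔ P) (ρ₀ q) ≡ (ρ [ x ↦ P ]) q
    ≔-after-ρ₀ P q with q ≟ x
    ... | yes refl = [↦]-same var x P
    ... | no q≢x = sub-≔-unused (x∉ρ q≢x)

    A* : Fm
    A* = sub ρ₀ (φ x)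

    A*-modalized : Modalized x A*
    A*-modalized = Modalized-sub ρ₀ (φ x) modalized-or-x-free
      where
      modalized-or-x-free : ∀ q → Modalized q (φ x) ⊎ Modalized x (ρ₀ q)
      modalized-or-x-free q with q ≟ x
      ... | yes refl = inj₁ (modalized (here refl))
      ... | no q≢x = inj₂ (¬Occurs⇒Modalized (ρ q) (x∉ρ q≢x))

    ≔-A* : ∀ P → sub (x ≔ P) A* ≡ sub (ρ [ x ↦ P ]) (φ x)
    ≔-A* P = trans (sub-∘ (x ≔ P) ρ₀ (φ x)) (sub-cong (φ x) (λ q _ → ≔-after-ρ₀ P q))

    ρ₀-after-≔H : ∀ A → sub ρ₀ (sub (x ≔ H) A) ≡ sub (ρ [ x ↦ K₀ ]) A
    ρ₀-after-≔H A = trans (sub-≔ ρ₀ x H A) (sub-cong A (λ q _ → [↦]-[↦] ρ x (var x) K₀ q))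

    ρx⇔K₀ : IL⊢ (ρ x ⇔ K₀)
    ρx⇔K₀ = fixedPoint-unique x A* A*-modalized ρx-fixed K₀-fixed
      where
      ρx-fixed : IL⊢ (ρ x ⇔ sub (x ≔ ρ x) A*)
      ρx-fixed = subst (λ F → IL⊢ (ρ x ⇔ F))
        (sym (trans (≔-A* (ρ x)) (sub-cong (φ x) (λ q _ → [↦]-id ρ x q))))
        (equation s (here refl))
      K₀-fixed : IL⊢ (K₀ ⇔ sub (x ≔ K₀) A*)
      K₀-fixed = subst (λ F → IL⊢ (K₀ ⇔ F)) (trans (ρ₀-after-≔H (φ x)) (sym (≔-A* K₀)))
                       (⊢-sub ρ₀ H-fixed)

    ρ⇔ρ[x↦K₀] : ∀ q → IL⊢ (ρ q ⇔ (ρ [ x ↦ K₀ ]) q)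
    ρ⇔ρ[x↦K₀] q with q ≟ x
    ... | yes refl = ρx⇔K₀
    ... | no _ = ⇔-refl

    restrict : Solves L W φ′ ρ₀
    restrict = record { outside = outside₀ ; voc = voc₀ ; equation = equation₀ }
      where
      ρ₀-on-L : ∀ {y} → y ∈ L → ρ₀ y ≡ ρ y
      ρ₀-on-L = [↦]-other ρ (var x) ∘ ∈L⇒≢x
      outside₀ : ∀ {y} → y ∉ L → ρ₀ y ≡ var y
      outside₀ {y} y∉L with y ≟ x
      ... | yes refl = refl
      ... | no y≢x = outside s λ { (here y≡x) → y≢x y≡x ; (there y∈L) → y∉L y∈L }
      voc₀ : ∀ {y} → y ∈ L → VocIn (ρ₀ y) W
      voc₀ y∈L rewrite ρ₀-on-L y∈L = voc s (there y∈L)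
      equation₀ : ∀ {y} → y ∈ L → IL⊢ (ρ₀ y ⇔ sub ρ₀ (φ′ y))
      equation₀ {y} y∈L rewrite ρ₀-on-L y∈L | ρ₀-after-≔H (φ y) =
        ⇔-trans (equation s (there y∈L)) (sub-⇔ ρ (ρ [ x ↦ K₀ ]) (φ y) (λ q _ → ρ⇔ρ[x↦K₀] q))

-- A variable repeated in L is solved at its last occurrence.
solve : ∀ L → Ordered L φ → SystemOver L W φ → (∀ {q} → q ∈ L → ¬ W q) → ∃ (Solves L W φ)
solve [] _ _ _ = var , record { outside = λ _ → refl ; voc = λ () ; equation = λ () }
solve (x ∷ L) (mx , ord) sys disjoint with x ∈? L
... | yes x∈L = Prod.map₂ (Solves-resp L⊆x∷L x∷L⊆L)
                          (solve L ord (SystemOver-resp x∷L⊆L L⊆x∷L sys) (disjoint ∘ there))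
  where
  x∷L⊆L : x ∷ L ⊆ L
  x∷L⊆L = ∈-∷⁺ʳ x∈L ⊆-refl
  L⊆x∷L : L ⊆ x ∷ L
  L⊆x∷L = xs⊆x∷xs L x
... | no x∉L = _ , extend (proj₂ (solve L (φ′-ordered ord) φ′-system (disjoint ∘ there)))
  where open Elimination x∉L (disjoint (here refl)) sys mx

unique : ∀ L → Ordered L φ → SystemOver L W φ → (∀ {q} → q ∈ L → ¬ W q) →
         Solves L W φ ρ → Solves L W φ ρ′ → ∀ {x} → x ∈ L → IL⊢ (ρ x ⇔ ρ′ x)
unique [] _ _ _ _ _ ()
unique {ρ = ρ} {ρ′ = ρ′} (x ∷ L) (mx , ord) sys disjoint s s′ with x ∈? L
... | yes x∈L =
  unique L ord (SystemOver-resp x∷L⊆L L⊆x∷L sys) (disjoint ∘ there)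
         (Solves-resp x∷L⊆L L⊆x∷L s) (Solves-resp x∷L⊆L L⊆x∷L s′) ∘ x∷L⊆L
  where
  x∷L⊆L : x ∷ L ⊆ L
  x∷L⊆L = ∈-∷⁺ʳ x∈L ⊆-refl
  L⊆x∷L : L ⊆ x ∷ L
  L⊆x∷L = xs⊆x∷xs L x
... | no x∉L = λ { (here refl) → ρx⇔ρ′x ; (there y∈L) → ρy⇔ρ′y y∈L }
  where
  open Elimination x∉L (disjoint (here refl)) sys mx
  module R = Restriction s
  module R′ = Restriction s′
  IH : ∀ {y} → y ∈ L → IL⊢ (R.ρ₀ y ⇔ R′.ρ₀ y)
  IH = unique L (φ′-ordered ord) φ′-system (disjoint ∘ there) R.restrict R′.restrict
  ρx⇔ρ′x : IL⊢ (ρ x ⇔ ρ′ x)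
  ρx⇔ρ′x = ⇔-trans R.ρx⇔K₀ (⇔-trans K₀⇔K₀′ (⇔-sym R′.ρx⇔K₀))
    where
    K₀⇔K₀′ : IL⊢ (R.K₀ ⇔ R′.K₀)
    K₀⇔K₀′ = sub-⇔ R.ρ₀ R′.ρ₀ H (λ q _ → Solves-⇔ R.restrict R′.restrict IH q)
  ρy⇔ρ′y : ∀ {y} → y ∈ L → IL⊢ (ρ y ⇔ ρ′ y)
  ρy⇔ρ′y y∈L = subst₂ (λ P Q → IL⊢ (P ⇔ Q)) ([↦]-other _ (var x) (∈L⇒≢x y∈L))
                      ([↦]-other _ (var x) (∈L⇒≢x y∈L)) (IH y∈L)

subOn-∈ : ∀ {B} ψ {x} → x ∈ B → subOn B ψ x ≡ ψ x
subOn-∈ {B} ψ {x} x∈B with x ∈? B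
... | yes _ = refl
... | no x∉B = contradiction x∈B x∉B

subOn-∉ : ∀ {B} ψ {x} → x ∉ B → subOn B ψ x ≡ var x
subOn-∉ {B} ψ {x} x∉B with x ∈? B
... | yes x∈B = contradiction x∈B x∉B
... | no _ = refl

IsSolution⇒Solves : ∀ {B V} → IsSolution B V φ ψ → Solves B (_∈ V) φ (subOn B ψ)
IsSolution⇒Solves {φ} {ψ} {B} sol = record
  { outside = subOn-∉ ψ
  ; voc = λ {x} x∈B → subst (λ F → VocIn F _) (sym (subOn-∈ ψ x∈B)) (proj₁ (sol x x∈B))
  ; equation = λ {x} x∈B →
      subst (λ F → IL⊢ (F ⇔ sub (subOn B ψ) (φ x))) (sym (subOn-∈ ψ x∈B)) (proj₂ (sol x x∈B))
  }

Solves⇒IsSolution : ∀ {B V} → Solves B (_∈ V) φ ρ → IsSolution B V φ ρ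
Solves⇒IsSolution {φ} {ρ} {B} s x x∈B =
  voc s x∈B ,
  subst (λ F → IL⊢ (ρ x ⇔ F)) (sub-cong (φ x) (λ q _ → sym (subOn-self q))) (equation s x∈B)
  where
  subOn-self : ∀ q → subOn B ρ q ≡ ρ q
  subOn-self q with q ∈? B
  ... | yes _ = refl
  ... | no q∉B = sym (outside s q∉B)

mainTheorem12 : (B V : List Var) → Disjoint B V →
    (φ : Var → Fm) → IsSystem B V φ → Orderable B φ →
    Σ (Var → Fm) (λ ψ → IsSolution B V φ ψ) ×
    ((ψ ψ′ : Var → Fm) → IsSolution B V φ ψ → IsSolution B V φ ψ′ →
      (x : Var) → x ∈ B → IL⊢ (ψ x ⇔ ψ′ x))
mainTheorem12 B V B∩V=∅ φ system (L , L↭B , ordering) =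
  (proj₁ solution , Solves⇒IsSolution (Solves-resp L⊆B B⊆L (proj₂ solution))) ,
  λ ψ ψ′ ψ-solves ψ′-solves x x∈B →
    subst₂ (λ P Q → IL⊢ (P ⇔ Q)) (subOn-∈ ψ x∈B) (subOn-∈ ψ′ x∈B)
      (unique L ordered systemL disjointL (onL ψ-solves) (onL ψ′-solves) (B⊆L x∈B))
  where
  L⊆B : L ⊆ B
  L⊆B = ⊆-reflexive-↭ L↭B
  B⊆L : B ⊆ L
  B⊆L = ⊆-reflexive-↭ (↭-sym L↭B)
  ordered : Ordered L φ
  ordered = Ordered-fromIndices L ordering
  systemL : SystemOver L (_∈ V) φ
  systemL = SystemOver-resp B⊆L L⊆B system
  disjointL : ∀ {q} → q ∈ L → q ∉ V
  disjointL q∈L = B∩V=∅ _ (L⊆B q∈L)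
  solution : ∃ (Solves L (_∈ V) φ)
  solution = solve L ordered systemL disjointL
  onL : ∀ {ψ} → IsSolution B V φ ψ → Solves L (_∈ V) φ (subOn B ψ)
  onL = Solves-resp B⊆L L⊆B ∘ IsSolution⇒Solves
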